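{- We rewrite ${\mathbf B}_k=\sum_{\alpha\in G_{k,p}}\alpha\sqcup\!\sqcup W_{k,n}$ by grouping the terms by the head (or top) letter as follows: \[ {\mathbf B}_k = \sum_{t\in (C_p\times[k]) \cup\{(0,k+1)\}} {\mathbf C}_{k}(t), \] where ${\mathbf C}_k (t)$ is the sum of the elements in ${\mathbf B}_k$ whose leading letter is $t$. We then have \[ {\mathbf C}_k (t){\mathbf B}_1= \begin{cases} {\mathbf B}_k & t\in C_p\times[k],\\ {\mathbf B}_{k+1} & t=(0,k+1). \end{cases} \]
   Context: $G_{n,p}=C_p\wr\mathfrak S_n$ is the colored permutation group (pairs $(s,\sigma)$, $s\in C_p^n$, $\sigma\in\mathfrak S_n$, product $(t,\tau)(s,\sigma)=(\sigma t+s,\tau\sigma)$, $\sigma t=(t_{\sigma(1)},\ldots,t_{\sigma(n)})$), whose elements are regarded as words $(s_1,\sigma(1))\cdots(s_n,\sigma(n))$ over $C_p\times[n]$. For words $u,v$, $u\sqcup\!\sqcup v$ is the shuffle product (formal sum of all interleavings of $u$ and $v$). Let $W_{k,n}=(0,k+1)(0,k+2)\cdots(0,n)$ and define in ${\mathbb Q}G_{n,p}$: ${\mathbf B}_k=\sum_{\alpha\in G_{k,p}}\alpha\sqcup\!\sqcup W_{k,n}$ for $1\le k\le n-1$, ${\mathbf B}_n=\sum_{\alpha\in G_{n,p}}\alpha$. Here $1\le k\le n-1$. -}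

module Defs where

open import Data.Nat using (ℕ; zero; suc; _+_; _∸_; _<ᵇ_; NonZero)
open import Data.Nat.DivMod using (_mod_)
open import Data.Nat.Properties using () renaming (_≟_ to _≟ℕ_)
open import Data.Fin using (Fin; toℕ) renaming (_≟_ to _≟F_)
open import Data.Product using (_×_; _,_; proj₁; proj₂)
open import Data.Product.Properties using (≡-dec)
open import Data.List using (List; []; _∷_; map; _++_; concatMap; applyUpTo; cartesianProduct; filter; filterᵇ; foldr; allFin)
import Data.List.Properties as LP
open import Data.Maybe using (Maybe; just; nothing)
open import Data.Bool using (Bool; true; false; if_then_else_)
open import Data.Rational using (ℚ; 0ℚ; 1ℚ) renaming (_+_ to _+ℚ_; _*_ to _*ℚ_)
open import Relation.Nullary using (does)
open import Relation.Binary.PropositionalEquality using (_≡_)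
open import Relation.Binary.Definitions using (DecidableEquality)
open import Data.List.Relation.Unary.Unique.DecPropositional _≟ℕ_ using (unique?)

-- Letters are pairs (colour , value) ∈ C_p × ℕ, with C_p = Fin p and
-- values 1-based as in the paper ([n] = {1,…,n}).
Letter : ℕ → Set
Letter p = Fin p × ℕ

Word : ℕ → Set
Word p = List (Letter p)

_≟L_ : ∀ {p} → DecidableEquality (Letter p)
_≟L_ = ≡-dec _≟F_ _≟ℕ_

_≟W_ : ∀ {p} → DecidableEquality (Word p)
_≟W_ = LP.≡-dec _≟L_

c0 : (p : ℕ) → .{{NonZero p}} → Fin p
c0 p = 0 mod p

addC : (p : ℕ) → .{{NonZero p}} → Fin p → Fin p → Fin p
addC p a b = (toℕ a + toℕ b) mod p

range1 : ℕ → List ℕ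
range1 n = applyUpTo suc n

wordsOf : ∀ {A : Set} → List A → ℕ → List (List A)
wordsOf L zero    = [] ∷ []
wordsOf L (suc m) = concatMap (λ l → map (l ∷_) (wordsOf L m)) L

-- G_{n,p} : all words (s₁,σ(1))⋯(s_n,σ(n)) with σ a permutation of [n]
-- (length n, values in [n], pairwise distinct values).
G : (p : ℕ) → ℕ → List (Word p)
G p n = filter (λ w → unique? (map proj₂ w))
               (wordsOf (cartesianProduct (allFin p) (range1 n)) n)

at : ∀ {A : Set} → List A → ℕ → Maybe A
at []       _       = nothing
at (x ∷ xs) zero    = just x
at (x ∷ xs) (suc i) = at xs i

-- group product (t,τ)(s,σ) = (σt+s, τσ) on words:
-- position i of the product is (t_{σ(i)} + s_i , τ(σ(i))).
mulW : (p : ℕ) → .{{NonZero p}} → Word p → Word p → Word p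
mulW p u v = map f v
  where
  f : Letter p → Letter p
  f (s , j) with at u (j ∸ 1)
  ... | just (t , m) = (addC p t s , m)
  ... | nothing      = (s , j)

shuffle : ∀ {A : Set} → List A → List A → List (List A)
shuffle []       v        = v ∷ []
shuffle (a ∷ u)  []       = (a ∷ u) ∷ []
shuffle (a ∷ u)  (b ∷ v)  = map (a ∷_) (shuffle u (b ∷ v)) ++ map (b ∷_) (shuffle (a ∷ u) v)

-- The group algebra ℚ G_{n,p}: formal finite ℚ-linear combinations of
-- words, compared via their coefficient functions.

QG : ℕ → Set
QG p = List (ℚ × Word p)

coeff : ∀ {p} → QG p → Word p → ℚ
coeff xs w = foldr (λ { (q , u) acc → if does (u ≟W w) then q +ℚ acc else acc }) 0ℚ xs

_≈_ : ∀ {p} → QG p → QG p → Set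
x ≈ y = ∀ w → coeff x w ≡ coeff y w

sumOf : ∀ {p} → List (Word p) → QG p
sumOf = map (λ w → (1ℚ , w))

mulQ : (p : ℕ) → .{{NonZero p}} → QG p → QG p → QG p
mulQ p xs ys = concatMap (λ { (a , u) → map (λ { (b , v) → (a *ℚ b , mulW p u v) }) ys }) xs

Wkn : (p : ℕ) → .{{NonZero p}} → ℕ → ℕ → Word p
Wkn p k n = applyUpTo (λ i → (c0 p , suc (k + i))) (n ∸ k)

Bterms : (p : ℕ) → .{{NonZero p}} → ℕ → ℕ → List (Word p)
Bterms p n k = if k <ᵇ n
               then concatMap (λ α → shuffle α (Wkn p k n)) (G p k)
               else G p n

B : (p : ℕ) → .{{NonZero p}} → ℕ → ℕ → QG p
B p n k = sumOf (Bterms p n k)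

headIs : ∀ {p} → Letter p → Word p → Bool
headIs t []      = false
headIs t (x ∷ _) = does (x ≟L t)

C : (p : ℕ) → .{{NonZero p}} → ℕ → ℕ → Letter p → QG p
C p n k t = sumOf (filterᵇ (headIs t) (Bterms p n k))

heads : (p : ℕ) → .{{NonZero p}} → ℕ → List (Letter p)
heads p k = cartesianProduct (allFin p) (range1 k) ++ ((c0 p , suc k) ∷ [])

sumC : (p : ℕ) → .{{NonZero p}} → ℕ → ℕ → QG p
sumC p n k = concatMap (C p n k) (heads p k)

-- All identities are proved by comparing multiplicities of words: ≈ compares coefficients, and
-- every sum involved has coefficients 1. A word w occurs in B_k, and then exactly once, iff its
-- letters of value > k form W_{k,n} and the values of its other letters list 1,…,k once each
-- (splitting w by value recovers the unique α and shuffle it comes from). Such a w starts either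
-- with a letter of C_p × [k] or with (0,k+1), which gives B_k = Σ_t C_k(t).
-- For the products, B_1 = Σ_c (c,1) ⧢ W_{1,n}, and for u = (d,j)u' of length n the product of u
-- with (c,1) ⧢ W_{1,n} is (d+c,j) ⧢ u'. Summing over the colours c, w occurs in C_k(d,j) B_1 iff
-- the value j occurs once in w and (d,j) followed by the other letters of w lies in B_k. Comparing
-- the multiplicities of each value, this says w ∈ B_k when j ≤ k, and w ∈ B_{k+1} when
-- (d,j) = (0,k+1).

module Submission where

open import Defs
open import Data.Nat using (ℕ; zero; suc; pred; _≤_; _<_; NonZero; _+_; _*_; _∸_; z≤n; s≤s; _<ᵇ_)
open import Data.Fin using (Fin; toℕ)
open import Data.Product using (_×_; _,_; proj₁; proj₂)

import Algebra.Properties.CommutativeSemigroup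
open import Data.Bool using (true; false; if_then_else_)
open import Data.Bool.Properties using (T-≡)
open import Data.Empty using (⊥-elim)
import Data.Fin as Fin
import Data.Fin.Properties as Fin
open import Data.List using (List; []; _∷_; map; _++_; concatMap; length; filter; filterᵇ; cartesianProduct; allFin; applyUpTo)
import Data.List.Properties as List
open import Data.List.Membership.Propositional using (_∈_)
open import Data.List.Membership.Propositional.Properties using (∈-allFin)
open import Data.List.Relation.Unary.All using (All; []; _∷_)
import Data.List.Relation.Unary.All as All
import Data.List.Relation.Unary.All.Properties as All
open import Data.List.Relation.Unary.AllPairs using ([]; _∷_)
open import Data.List.Relation.Unary.Any using (here; there)
open import Data.List.Relation.Unary.Unique.Propositional using (Unique)
import Data.List.Relation.Unary.Unique.Propositional.Properties as Unique
open import Data.Maybe using (just)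
open import Data.Nat.DivMod using (_%_; _mod_; %-distribˡ-+; m%n%n≡m%n; [m+n]%n≡m%n; m<n⇒m%n≡m)
open import Data.Nat.GeneralisedArithmetic using (fold)
import Data.Nat.Properties as ℕ
import Data.Product.Properties as ×
open import Data.Rational using (0ℚ; 1ℚ) renaming (_+_ to _+ℚ_)
open import Data.Sum using (inj₁; inj₂)
open import Function using (_∘_; case_of_; Equivalence; _⇔_; mk⇔)
open import Level using (Level)
open import Relation.Binary.Definitions using (DecidableEquality)
open import Relation.Binary.PropositionalEquality using (_≡_; refl; sym; trans; cong; cong₂; subst; _≢_; module ≡-Reasoning)
open import Relation.Nullary using (Dec; yes; no; does; ¬_; ¬?)
open import Relation.Nullary.Decidable using (_×-dec_; map′; decidable-stable; T?)
open import Relation.Unary using (Pred; Decidable; ∁)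
open import Relation.Unary.Properties using (∁?)

open import Data.List.Relation.Unary.Unique.DecPropositional ℕ._≟_ using (unique?)
open Algebra.Properties.CommutativeSemigroup ℕ.+-commutativeSemigroup using (interchange)

private variable
  X Y : Set
  ℓ ℓ′ ℓ″ : Level
  P : Set ℓ
  Q : Set ℓ′

𝟙 : Dec P → ℕ
𝟙 d = if does d then 1 else 0

𝟙-yes : P → (d : Dec P) → 𝟙 d ≡ 1
𝟙-yes p (yes _) = refl
𝟙-yes p (no ¬p) = ⊥-elim (¬p p)

𝟙-no : ¬ P → (d : Dec P) → 𝟙 d ≡ 0
𝟙-no ¬p (yes p) = ⊥-elim (¬p p)
𝟙-no ¬p (no _)  = refl

𝟙-cong : (P → Q) → (Q → P) → (dp : Dec P) (dq : Dec Q) → 𝟙 dp ≡ 𝟙 dq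
𝟙-cong to from (yes p) dq = sym (𝟙-yes (to p) dq)
𝟙-cong to from (no ¬p) dq = sym (𝟙-no (¬p ∘ from) dq)

𝟙-× : (dp : Dec P) (dq : Dec Q) → 𝟙 (dp ×-dec dq) ≡ 𝟙 dp * 𝟙 dq
𝟙-× (yes _) (yes _) = refl
𝟙-× (yes _) (no _)  = refl
𝟙-× (no _)  _       = refl

𝟙-witness : (d : Dec P) → 1 ≤ 𝟙 d → P
𝟙-witness (yes p) _ = p

𝟙≤1 : (d : Dec P) → 𝟙 d ≤ 1
𝟙≤1 (yes _) = s≤s z≤n
𝟙≤1 (no _)  = z≤n

𝟙*-yes : P → (d : Dec P) → ∀ m → 𝟙 d * m ≡ m
𝟙*-yes p d m = trans (cong (_* m) (𝟙-yes p d)) (ℕ.*-identityˡ m)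

𝟙*-no : ¬ P → (d : Dec P) → ∀ m → 𝟙 d * m ≡ 0
𝟙*-no ¬p d m = cong (_* m) (𝟙-no ¬p d)

sumMap : (X → ℕ) → List X → ℕ
sumMap f []       = 0
sumMap f (x ∷ xs) = f x + sumMap f xs

sumMap-++ : ∀ (f : X → ℕ) xs ys → sumMap f (xs ++ ys) ≡ sumMap f xs + sumMap f ys
sumMap-++ f []       ys = refl
sumMap-++ f (x ∷ xs) ys = trans (cong (f x +_) (sumMap-++ f xs ys)) (sym (ℕ.+-assoc (f x) _ _))

sumMap-cong-∈ : ∀ {f g : X → ℕ} xs → (∀ x → x ∈ xs → f x ≡ g x) → sumMap f xs ≡ sumMap g xs
sumMap-cong-∈ []       h = refl
sumMap-cong-∈ (x ∷ xs) h = cong₂ _+_ (h x (here refl)) (sumMap-cong-∈ xs (λ y → h y ∘ there))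

sumMap-cong : ∀ {f g : X → ℕ} xs → (∀ x → f x ≡ g x) → sumMap f xs ≡ sumMap g xs
sumMap-cong xs h = sumMap-cong-∈ xs (λ x _ → h x)

sumMap-*ˡ : ∀ c (f : X → ℕ) xs → sumMap (λ x → c * f x) xs ≡ c * sumMap f xs
sumMap-*ˡ c f []       = sym (ℕ.*-zeroʳ c)
sumMap-*ˡ c f (x ∷ xs) = trans (cong (c * f x +_) (sumMap-*ˡ c f xs)) (sym (ℕ.*-distribˡ-+ c (f x) _))

sumMap-*ʳ : ∀ c (f : X → ℕ) xs → sumMap (λ x → f x * c) xs ≡ sumMap f xs * c
sumMap-*ʳ c f xs = trans (sumMap-cong xs (λ x → ℕ.*-comm (f x) c)) (trans (sumMap-*ˡ c f xs) (ℕ.*-comm c _))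

sumMap-zero : ∀ (xs : List X) → sumMap (λ _ → 0) xs ≡ 0
sumMap-zero []       = refl
sumMap-zero (x ∷ xs) = sumMap-zero xs

sumMap-one : ∀ (xs : List X) → sumMap (λ _ → 1) xs ≡ length xs
sumMap-one []       = refl
sumMap-one (x ∷ xs) = cong suc (sumMap-one xs)

sumMap-+ : ∀ (f g : X → ℕ) xs → sumMap (λ x → f x + g x) xs ≡ sumMap f xs + sumMap g xs
sumMap-+ f g []       = refl
sumMap-+ f g (x ∷ xs) = trans (cong (f x + g x +_) (sumMap-+ f g xs)) (interchange (f x) (g x) (sumMap f xs) (sumMap g xs))

sumMap-comm : ∀ (f : X → Y → ℕ) xs ys →
  sumMap (λ x → sumMap (f x) ys) xs ≡ sumMap (λ y → sumMap (λ x → f x y) xs) ys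
sumMap-comm f []       ys = sym (sumMap-zero ys)
sumMap-comm f (x ∷ xs) ys =
  trans (cong (sumMap (f x) ys +_) (sumMap-comm f xs ys)) (sym (sumMap-+ (f x) _ ys))

sumMap-mono : ∀ {f g : X → ℕ} xs → (∀ x → x ∈ xs → f x ≤ g x) → sumMap f xs ≤ sumMap g xs
sumMap-mono []       h = z≤n
sumMap-mono (x ∷ xs) h = ℕ.+-mono-≤ (h x (here refl)) (sumMap-mono xs (λ y → h y ∘ there))

sumMap-mono-≡ : ∀ {f g : X → ℕ} xs → (∀ x → x ∈ xs → f x ≤ g x) → sumMap f xs ≡ sumMap g xs →
  ∀ x → x ∈ xs → f x ≡ g x
sumMap-mono-≡ {f = f} {g = g} (y ∷ ys) le eq x x∈ = go x∈
  where
  le′ : ∀ z → z ∈ ys → f z ≤ g z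
  le′ z = le z ∘ there
  head≡ : f y ≡ g y
  head≡ = ℕ.≤-antisym (le y (here refl))
    (ℕ.+-cancelʳ-≤ _ _ _ (ℕ.≤-trans (ℕ.+-monoʳ-≤ (g y) (sumMap-mono ys le′)) (ℕ.≤-reflexive (sym eq))))
  go : x ∈ y ∷ ys → f x ≡ g x
  go (here refl) = head≡
  go (there x∈ys) = sumMap-mono-≡ ys le′ (ℕ.+-cancelˡ-≡ (g y) _ _ (trans (cong (_+ _) (sym head≡)) eq)) x x∈ys

sumMap-concatMap : ∀ (f : X → ℕ) (g : Y → List X) ys → sumMap f (concatMap g ys) ≡ sumMap (sumMap f ∘ g) ys
sumMap-concatMap f g []       = refl
sumMap-concatMap f g (y ∷ ys) = trans (sumMap-++ f (g y) _) (cong (sumMap f (g y) +_) (sumMap-concatMap f g ys))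

sumMap-filter : ∀ {R : Pred X ℓ} (R? : Decidable R) (f : X → ℕ) xs →
  sumMap f (filter R? xs) ≡ sumMap (λ x → 𝟙 (R? x) * f x) xs
sumMap-filter R? f [] = refl
sumMap-filter R? f (x ∷ xs) with R? x
... | yes _ = cong₂ _+_ (sym (ℕ.+-identityʳ (f x))) (sumMap-filter R? f xs)
... | no _  = sumMap-filter R? f xs

<ᵇ-irrefl : ∀ k → (k <ᵇ k) ≡ false
<ᵇ-irrefl zero    = refl
<ᵇ-irrefl (suc k) = <ᵇ-irrefl k

applyUpTo-cong : ∀ {f g : ℕ → X} → (∀ i → f i ≡ g i) → ∀ m → applyUpTo f m ≡ applyUpTo g m
applyUpTo-cong f≗g zero    = refl
applyUpTo-cong f≗g (suc m) = cong₂ _∷_ (f≗g 0) (applyUpTo-cong (f≗g ∘ suc) m)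

applyUpTo-at : ∀ (xs : List X) (g : ℕ → X) → (∀ i x → at xs i ≡ just x → g i ≡ x) → applyUpTo g (length xs) ≡ xs
applyUpTo-at []       g g≗xs = refl
applyUpTo-at (x ∷ xs) g g≗xs = cong₂ _∷_ (g≗xs 0 x refl) (applyUpTo-at xs (g ∘ suc) (g≗xs ∘ suc))

length-filter-∁ : ∀ {R : Pred X ℓ} (R? : Decidable R) xs → length (filter R? xs) + length (filter (∁? R?) xs) ≡ length xs
length-filter-∁ R? []       = refl
length-filter-∁ R? (x ∷ xs) with R? x
... | yes _ = cong suc (length-filter-∁ R? xs)
... | no _  = trans (ℕ.+-suc _ _) (cong suc (length-filter-∁ R? xs))

map-filter : ∀ (f : X → Y) {Q : Pred Y ℓ} (Q? : Decidable Q) xs → map f (filter (Q? ∘ f) xs) ≡ filter Q? (map f xs)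
map-filter f Q? []       = refl
map-filter f Q? (x ∷ xs) with does (Q? (f x))
... | true  = cong (f x ∷_) (map-filter f Q? xs)
... | false = map-filter f Q? xs

filter-filter : ∀ {Q : Pred X ℓ} {R : Pred X ℓ′} {S : Pred X ℓ″} (Q? : Decidable Q) (R? : Decidable R) (S? : Decidable S) →
  (∀ {x} → S x → R x × Q x) → (∀ {x} → R x → Q x → S x) → ∀ xs → filter R? (filter Q? xs) ≡ filter S? xs
filter-filter Q? R? S? S⇒ ⇒S []       = refl
filter-filter Q? R? S? S⇒ ⇒S (x ∷ xs) with Q? x | S? x
... | no ¬Qx | no _   = filter-filter Q? R? S? S⇒ ⇒S xs
... | no ¬Qx | yes Sx = ⊥-elim (¬Qx (proj₂ (S⇒ Sx)))
... | yes Qx | yes Sx = trans (List.filter-accept R? (proj₁ (S⇒ Sx))) (cong (x ∷_) (filter-filter Q? R? S? S⇒ ⇒S xs))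
... | yes Qx | no ¬Sx = trans (List.filter-reject R? (λ Rx → ¬Sx (⇒S Rx Qx))) (filter-filter Q? R? S? S⇒ ⇒S xs)

filter≡[]⇒all∁ : ∀ {R : Pred X ℓ} (R? : Decidable R) xs → filter R? xs ≡ [] → All (∁ R) xs
filter≡[]⇒all∁ R? []       _ = []
filter≡[]⇒all∁ R? (x ∷ xs) eq with R? x
... | no ¬Rx = ¬Rx ∷ filter≡[]⇒all∁ R? xs eq

shuffle-[] : ∀ (xs : List X) → shuffle xs [] ≡ xs ∷ []
shuffle-[] []       = refl
shuffle-[] (x ∷ xs) = refl

map-shuffle : ∀ (f : X → Y) u v → map (map f) (shuffle u v) ≡ shuffle (map f u) (map f v)
map-shuffle f []      v       = refl
map-shuffle f (a ∷ u) []      = refl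
map-shuffle f (a ∷ u) (b ∷ v) = begin
  map (map f) (map (a ∷_) (shuffle u (b ∷ v)) ++ map (b ∷_) (shuffle (a ∷ u) v))
    ≡⟨ List.map-++ (map f) (map (a ∷_) (shuffle u (b ∷ v))) _ ⟩
  map (map f) (map (a ∷_) (shuffle u (b ∷ v))) ++ map (map f) (map (b ∷_) (shuffle (a ∷ u) v))
    ≡⟨ cong₂ _++_ (map-map-∷ a (shuffle u (b ∷ v))) (map-map-∷ b (shuffle (a ∷ u) v)) ⟩
  map (f a ∷_) (map (map f) (shuffle u (b ∷ v))) ++ map (f b ∷_) (map (map f) (shuffle (a ∷ u) v))
    ≡⟨ cong₂ _++_ (cong (map (f a ∷_)) (map-shuffle f u (b ∷ v))) (cong (map (f b ∷_)) (map-shuffle f (a ∷ u) v)) ⟩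
  shuffle (map f (a ∷ u)) (map f (b ∷ v)) ∎
  where
  open ≡-Reasoning
  map-map-∷ : ∀ c xss → map (map f) (map (c ∷_) xss) ≡ map (f c ∷_) (map (map f) xss)
  map-map-∷ c xss = trans (sym (List.map-∘ xss)) (List.map-∘ xss)

module Multiplicity {X : Set} (_≟_ : DecidableEquality X) where

  count : X → List X → ℕ
  count w = sumMap (λ x → 𝟙 (x ≟ w))

  count-++ : ∀ w xs ys → count w (xs ++ ys) ≡ count w xs + count w ys
  count-++ w = sumMap-++ _

  count-concatMap : ∀ w (f : Y → List X) ys → count w (concatMap f ys) ≡ sumMap (count w ∘ f) ys
  count-concatMap w = sumMap-concatMap _

  count-sym : ∀ w xs → sumMap (λ x → 𝟙 (w ≟ x)) xs ≡ count w xs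
  count-sym w xs = sumMap-cong xs (λ x → 𝟙-cong sym sym (w ≟ x) (x ≟ w))

  count-∈ : ∀ {w xs} → w ∈ xs → 1 ≤ count w xs
  count-∈ {w} (here refl) = ℕ.≤-trans (ℕ.≤-reflexive (sym (𝟙-yes refl (w ≟ w)))) (ℕ.m≤m+n _ _)
  count-∈ {w} {x ∷ _} (there w∈) = ℕ.≤-trans (count-∈ w∈) (ℕ.m≤n+m _ (𝟙 (x ≟ w)))

  ∈-count : ∀ {w} xs → 1 ≤ count w xs → w ∈ xs
  ∈-count {w} (x ∷ xs) h with x ≟ w
  ... | yes refl = here refl
  ... | no _     = there (∈-count xs h)

  count-filter : ∀ {R : Pred X ℓ} (R? : Decidable R) w xs → count w (filter R? xs) ≡ 𝟙 (R? w) * count w xs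
  count-filter R? w xs = trans (sumMap-filter R? _ xs)
    (trans (sumMap-cong xs same) (sumMap-*ˡ (𝟙 (R? w)) _ xs))
    where
    same : ∀ x → 𝟙 (R? x) * 𝟙 (x ≟ w) ≡ 𝟙 (R? w) * 𝟙 (x ≟ w)
    same x with x ≟ w
    ... | yes refl = refl
    ... | no _     = trans (ℕ.*-zeroʳ (𝟙 (R? x))) (sym (ℕ.*-zeroʳ (𝟙 (R? w))))

  count≡0⇒all≢ : ∀ {w} xs → count w xs ≡ 0 → All (w ≢_) xs
  count≡0⇒all≢ []       _  = []
  count≡0⇒all≢ {w} (x ∷ xs) eq =
    (λ { refl → ℕ.<-irrefl refl (subst (1 ≤_) eq (count-∈ {w} {x ∷ xs} (here refl))) }) ∷
    count≡0⇒all≢ xs (ℕ.m+n≡0⇒n≡0 _ eq)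

  count-all≢ : ∀ {w} xs → All (w ≢_) xs → count w xs ≡ 0
  count-all≢ []       []         = refl
  count-all≢ {w} (x ∷ xs) (w≢x ∷ h) = cong₂ _+_ (𝟙-no (w≢x ∘ sym) (x ≟ w)) (count-all≢ xs h)

  unique⇒count≤1 : ∀ {xs} → Unique xs → ∀ v → count v xs ≤ 1
  unique⇒count≤1 []                     v = z≤n
  unique⇒count≤1 {x ∷ xs} (x∉xs ∷ uniq) v = go (x ≟ v)
    where
    go : (d : Dec (x ≡ v)) → 𝟙 d + count v xs ≤ 1
    go (yes refl) = s≤s (ℕ.≤-reflexive (count-all≢ xs x∉xs))
    go (no _)     = unique⇒count≤1 uniq v

  count≤1⇒unique : ∀ xs → (∀ v → count v xs ≤ 1) → Unique xs
  count≤1⇒unique []       _ = []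
  count≤1⇒unique (x ∷ xs) h = All.tabulate x∉xs ∷ count≤1⇒unique xs (λ v → ℕ.≤-trans (ℕ.m≤n+m _ _) (h v))
    where
    x∉xs : ∀ {y} → y ∈ xs → x ≢ y
    x∉xs y∈ refl = ℕ.<-irrefl refl (begin-strict
      1                 ≤⟨ count-∈ y∈ ⟩
      count x xs        <⟨ ℕ.n<1+n _ ⟩
      1 + count x xs    ≡⟨ cong (_+ count x xs) (𝟙-yes refl (x ≟ x)) ⟨
      count x (x ∷ xs)  ≤⟨ h x ⟩
      1                 ∎)
      where open ℕ.≤-Reasoning

  count-unique-∈ : ∀ {w xs} → Unique xs → w ∈ xs → count w xs ≡ 1
  count-unique-∈ {w} uniq w∈ = ℕ.≤-antisym (unique⇒count≤1 uniq w) (count-∈ w∈)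

module WordMultiplicity {X : Set} (_≟_ : DecidableEquality X) where

  open Multiplicity _≟_ using () renaming (count to countLetter)
  open Multiplicity (List.≡-dec _≟_)

  𝟙-∷ : ∀ a x (s w : List X) → 𝟙 (List.≡-dec _≟_ (a ∷ s) (x ∷ w)) ≡ 𝟙 (a ≟ x) * 𝟙 (List.≡-dec _≟_ s w)
  𝟙-∷ a x s w = trans (𝟙-cong (λ eq → List.∷-injectiveˡ eq , List.∷-injectiveʳ eq) (λ { (refl , refl) → refl })
                              (List.≡-dec _≟_ (a ∷ s) (x ∷ w)) ((a ≟ x) ×-dec List.≡-dec _≟_ s w))
                      (𝟙-× (a ≟ x) (List.≡-dec _≟_ s w))

  count-map-∷ : ∀ a x w (S : List (List X)) → count (x ∷ w) (map (a ∷_) S) ≡ 𝟙 (a ≟ x) * count w S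
  count-map-∷ a x w []       = sym (ℕ.*-zeroʳ (𝟙 (a ≟ x)))
  count-map-∷ a x w (s ∷ S) = trans (cong₂ _+_ (𝟙-∷ a x s w) (count-map-∷ a x w S))
                                    (sym (ℕ.*-distribˡ-+ (𝟙 (a ≟ x)) _ _))

  count-map-[] : ∀ a (S : List (List X)) → count [] (map (a ∷_) S) ≡ 0
  count-map-[] a []       = refl
  count-map-[] a (s ∷ S) = count-map-[] a S

  count-wordsOf : ∀ (A : List X) {R : Pred X ℓ} (R? : Decidable R) → (∀ x → countLetter x A ≡ 𝟙 (R? x)) →
    ∀ m w → count w (wordsOf A m) ≡ 𝟙 ((length w ℕ.≟ m) ×-dec All.all? R? w)
  count-wordsOf A R? countA zero    []      = refl
  count-wordsOf A R? countA zero    (x ∷ w) = refl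
  count-wordsOf A R? countA (suc m) []      = begin
    count [] (concatMap (λ a → map (a ∷_) (wordsOf A m)) A) ≡⟨ count-concatMap [] _ A ⟩
    sumMap (λ a → count [] (map (a ∷_) (wordsOf A m))) A    ≡⟨ sumMap-cong A (λ a → count-map-[] a (wordsOf A m)) ⟩
    sumMap (λ _ → 0) A                                       ≡⟨ sumMap-zero A ⟩
    0                                                        ∎
    where open ≡-Reasoning
  count-wordsOf A R? countA (suc m) (x ∷ w) = begin
    count (x ∷ w) (concatMap (λ a → map (a ∷_) (wordsOf A m)) A)  ≡⟨ count-concatMap (x ∷ w) _ A ⟩
    sumMap (λ a → count (x ∷ w) (map (a ∷_) (wordsOf A m))) A     ≡⟨ sumMap-cong A (λ a → count-map-∷ a x w (wordsOf A m)) ⟩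
    sumMap (λ a → 𝟙 (a ≟ x) * count w (wordsOf A m)) A            ≡⟨ sumMap-*ʳ (count w (wordsOf A m)) (λ a → 𝟙 (a ≟ x)) A ⟩
    countLetter x A * count w (wordsOf A m)                        ≡⟨ cong₂ _*_ (countA x) (count-wordsOf A R? countA m w) ⟩
    𝟙 (R? x) * 𝟙 ((length w ℕ.≟ m) ×-dec All.all? R? w)          ≡⟨ 𝟙-× (R? x) ((length w ℕ.≟ m) ×-dec All.all? R? w) ⟨
    𝟙 (R? x ×-dec ((length w ℕ.≟ m) ×-dec All.all? R? w))        ≡⟨ 𝟙-cong (λ (r , len , rs) → cong suc len , r ∷ rs)
                                                                        (λ { (len , r ∷ rs) → r , ℕ.suc-injective len , rs })
                                                                        (R? x ×-dec ((length w ℕ.≟ m) ×-dec All.all? R? w))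
                                                                        ((length (x ∷ w) ℕ.≟ suc m) ×-dec All.all? R? (x ∷ w)) ⟩
    𝟙 ((length (x ∷ w) ℕ.≟ suc m) ×-dec All.all? R? (x ∷ w))     ∎
    where open ≡-Reasoning

  module _ {P : Pred X ℓ} (P? : Decidable P) where

    splits? : ∀ α β w → Dec (filter P? w ≡ α × filter (∁? P?) w ≡ β)
    splits? α β w = List.≡-dec _≟_ (filter P? w) α ×-dec List.≡-dec _≟_ (filter (∁? P?) w) β

    count-shuffle-∷ : ∀ a α b β x w → count (x ∷ w) (shuffle (a ∷ α) (b ∷ β))
      ≡ 𝟙 (a ≟ x) * count w (shuffle α (b ∷ β)) + 𝟙 (b ≟ x) * count w (shuffle (a ∷ α) β)
    count-shuffle-∷ a α b β x w = trans (count-++ (x ∷ w) (map (a ∷_) (shuffle α (b ∷ β))) _)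
      (cong₂ _+_ (count-map-∷ a x w (shuffle α (b ∷ β))) (count-map-∷ b x w (shuffle (a ∷ α) β)))

    count-shuffle-∷ˡ : ∀ {a α b β x} w → P x → ¬ P b →
      count w (shuffle α (b ∷ β)) ≡ 𝟙 (splits? α (b ∷ β) w) →
      count (x ∷ w) (shuffle (a ∷ α) (b ∷ β)) ≡ 𝟙 (splits? (a ∷ α) (b ∷ β) (x ∷ w))
    count-shuffle-∷ˡ {a} {α} {b} {β} {x} w Px ¬Pb ih = begin
      count (x ∷ w) (shuffle (a ∷ α) (b ∷ β))
        ≡⟨ count-shuffle-∷ a α b β x w ⟩
      𝟙 (a ≟ x) * count w (shuffle α (b ∷ β)) + 𝟙 (b ≟ x) * count w (shuffle (a ∷ α) β)
        ≡⟨ cong₂ _+_ (cong (𝟙 (a ≟ x) *_) ih)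
                     (cong (_* count w (shuffle (a ∷ α) β)) (𝟙-no (λ { refl → ¬Pb Px }) (b ≟ x))) ⟩
      𝟙 (a ≟ x) * 𝟙 (splits? α (b ∷ β) w) + 0
        ≡⟨ trans (𝟙-× (a ≟ x) (splits? α (b ∷ β) w)) (sym (ℕ.+-identityʳ _)) ⟨
      𝟙 ((a ≟ x) ×-dec splits? α (b ∷ β) w)
        ≡⟨ 𝟙-cong (λ { (refl , eqP , eq∁) → trans (List.filter-accept P? Px) (cong (x ∷_) eqP) ,
                                               trans (List.filter-reject (∁? P?) (λ ¬Px → ¬Px Px)) eq∁ })
                  (λ (eqP , eq∁) → let eq = trans (sym (List.filter-accept P? Px)) eqP in
                     sym (List.∷-injectiveˡ eq) , List.∷-injectiveʳ eq ,
                     trans (sym (List.filter-reject (∁? P?) (λ ¬Px → ¬Px Px))) eq∁)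
                  ((a ≟ x) ×-dec splits? α (b ∷ β) w) (splits? (a ∷ α) (b ∷ β) (x ∷ w)) ⟩
      𝟙 (splits? (a ∷ α) (b ∷ β) (x ∷ w)) ∎
      where open ≡-Reasoning

    count-shuffle-∷ʳ : ∀ {a α b β x} w → ¬ P x → P a →
      count w (shuffle (a ∷ α) β) ≡ 𝟙 (splits? (a ∷ α) β w) →
      count (x ∷ w) (shuffle (a ∷ α) (b ∷ β)) ≡ 𝟙 (splits? (a ∷ α) (b ∷ β) (x ∷ w))
    count-shuffle-∷ʳ {a} {α} {b} {β} {x} w ¬Px Pa ih = begin
      count (x ∷ w) (shuffle (a ∷ α) (b ∷ β))
        ≡⟨ count-shuffle-∷ a α b β x w ⟩
      𝟙 (a ≟ x) * count w (shuffle α (b ∷ β)) + 𝟙 (b ≟ x) * count w (shuffle (a ∷ α) β)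
        ≡⟨ cong₂ _+_ (cong (_* count w (shuffle α (b ∷ β))) (𝟙-no (λ { refl → ¬Px Pa }) (a ≟ x)))
                     (cong (𝟙 (b ≟ x) *_) ih) ⟩
      𝟙 (b ≟ x) * 𝟙 (splits? (a ∷ α) β w)
        ≡⟨ 𝟙-× (b ≟ x) (splits? (a ∷ α) β w) ⟨
      𝟙 ((b ≟ x) ×-dec splits? (a ∷ α) β w)
        ≡⟨ 𝟙-cong (λ { (refl , eqP , eq∁) → trans (List.filter-reject P? ¬Px) eqP ,
                                               trans (List.filter-accept (∁? P?) ¬Px) (cong (x ∷_) eq∁) })
                  (λ (eqP , eq∁) → let eq = trans (sym (List.filter-accept (∁? P?) ¬Px)) eq∁ in
                     sym (List.∷-injectiveˡ eq) , trans (sym (List.filter-reject P? ¬Px)) eqP ,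
                     List.∷-injectiveʳ eq)
                  ((b ≟ x) ×-dec splits? (a ∷ α) β w) (splits? (a ∷ α) (b ∷ β) (x ∷ w)) ⟩
      𝟙 (splits? (a ∷ α) (b ∷ β) (x ∷ w)) ∎
      where open ≡-Reasoning

    count-shuffle : ∀ α β w → All P α → All (∁ P) β → count w (shuffle α β) ≡ 𝟙 (splits? α β w)
    count-shuffle [] β w _ ∁Pβ = trans (ℕ.+-identityʳ _) (𝟙-cong
      (λ { refl → List.filter-none P? ∁Pβ , List.filter-all (∁? P?) ∁Pβ })
      (λ (none , rest) → trans (sym rest) (List.filter-all (∁? P?) (filter≡[]⇒all∁ P? w none)))
      (List.≡-dec _≟_ β w) (splits? [] β w))
    count-shuffle (a ∷ α) [] w Pα _ = trans (ℕ.+-identityʳ _) (𝟙-cong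
      (λ { refl → List.filter-all P? Pα , List.filter-none (∁? P?) (All.map (λ Pa ¬Pa → ¬Pa Pa) Pα) })
      (λ (all , none) → trans (sym all) (List.filter-all P?
        (All.map (λ {x} → decidable-stable (P? x)) (filter≡[]⇒all∁ (∁? P?) w none))))
      (List.≡-dec _≟_ (a ∷ α) w) (splits? (a ∷ α) [] w))
    count-shuffle (a ∷ α) (b ∷ β) [] _ _ = trans
      (count-++ [] (map (a ∷_) (shuffle α (b ∷ β))) _)
      (cong₂ _+_ (count-map-[] a (shuffle α (b ∷ β))) (count-map-[] b (shuffle (a ∷ α) β)))
    count-shuffle (a ∷ α) (b ∷ β) (x ∷ w) (Pa ∷ Pα) (¬Pb ∷ ∁Pβ) = by (P? x)
      where
      by : Dec (P x) → count (x ∷ w) (shuffle (a ∷ α) (b ∷ β)) ≡ 𝟙 (splits? (a ∷ α) (b ∷ β) (x ∷ w))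
      by (yes Px) = count-shuffle-∷ˡ w Px ¬Pb (count-shuffle α (b ∷ β) w Pα (¬Pb ∷ ∁Pβ))
      by (no ¬Px) = count-shuffle-∷ʳ w ¬Px Pa (count-shuffle (a ∷ α) β w (Pa ∷ Pα) ∁Pβ)

module _ {X Y : Set} (_≟X_ : DecidableEquality X) (_≟Y_ : DecidableEquality Y) where

  private
    module CX  = Multiplicity _≟X_
    module CY  = Multiplicity _≟Y_
    module CXY = Multiplicity (×.≡-dec _≟X_ _≟Y_)

  𝟙-, : ∀ a x b y → 𝟙 (×.≡-dec _≟X_ _≟Y_ (a , b) (x , y)) ≡ 𝟙 (a ≟X x) * 𝟙 (b ≟Y y)
  𝟙-, a x b y = trans (𝟙-cong (λ eq → cong proj₁ eq , cong proj₂ eq) (λ { (refl , refl) → refl })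
                              (×.≡-dec _≟X_ _≟Y_ (a , b) (x , y)) ((a ≟X x) ×-dec (b ≟Y y)))
                      (𝟙-× (a ≟X x) (b ≟Y y))

  count-map-, : ∀ a x y R → CXY.count (x , y) (map (a ,_) R) ≡ 𝟙 (a ≟X x) * CY.count y R
  count-map-, a x y []      = sym (ℕ.*-zeroʳ (𝟙 (a ≟X x)))
  count-map-, a x y (b ∷ R) = trans (cong₂ _+_ (𝟙-, a x b y) (count-map-, a x y R)) (sym (ℕ.*-distribˡ-+ (𝟙 (a ≟X x)) _ _))

  count-cartesianProduct : ∀ x y L R → CXY.count (x , y) (cartesianProduct L R) ≡ CX.count x L * CY.count y R
  count-cartesianProduct x y []      R = refl
  count-cartesianProduct x y (a ∷ L) R = begin
    CXY.count (x , y) (map (a ,_) R ++ cartesianProduct L R)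
      ≡⟨ CXY.count-++ (x , y) (map (a ,_) R) _ ⟩
    CXY.count (x , y) (map (a ,_) R) + CXY.count (x , y) (cartesianProduct L R)
      ≡⟨ cong₂ _+_ (count-map-, a x y R) (count-cartesianProduct x y L R) ⟩
    𝟙 (a ≟X x) * CY.count y R + CX.count x L * CY.count y R
      ≡⟨ ℕ.*-distribʳ-+ (CY.count y R) (𝟙 (a ≟X x)) _ ⟨
    CX.count x (a ∷ L) * CY.count y R ∎
    where open ≡-Reasoning

module Countℕ = Multiplicity ℕ._≟_

module CountFin {p : ℕ} = Multiplicity (Fin._≟_ {p})

module CountLetter {p : ℕ} = Multiplicity (_≟L_ {p})

open module CountWord {p : ℕ} = Multiplicity (_≟W_ {p})

coeff-sumOf : ∀ {p} (xs : List (Word p)) w → coeff (sumOf xs) w ≡ fold 0ℚ (1ℚ +ℚ_) (count w xs)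
coeff-sumOf []       w = refl
coeff-sumOf (u ∷ xs) w with u ≟W w
... | yes _ = cong (1ℚ +ℚ_) (coeff-sumOf xs w)
... | no _  = coeff-sumOf xs w

sumOf-cong : ∀ {p} (xs ys : List (Word p)) → (∀ w → count w xs ≡ count w ys) → sumOf xs ≈ sumOf ys
sumOf-cong xs ys h w = trans (coeff-sumOf xs w) (trans (cong (fold 0ℚ (1ℚ +ℚ_)) (h w)) (sym (coeff-sumOf ys w)))

concatMap-sumOf : ∀ {p} (f : X → List (Word p)) xs → concatMap (sumOf ∘ f) xs ≡ sumOf (concatMap f xs)
concatMap-sumOf f []       = refl
concatMap-sumOf f (x ∷ xs) = trans (cong (sumOf (f x) ++_) (concatMap-sumOf f xs)) (sym (List.map-++ _ (f x) _))

module _ (p : ℕ) .{{_ : NonZero p}} where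

  mulQ-singleton : (u : Word p) (ys : List (Word p)) →
    mulQ p (sumOf (u ∷ [])) (sumOf ys) ≡ sumOf (map (mulW p u) ys) ++ []
  mulQ-singleton u []       = refl
  mulQ-singleton u (y ∷ ys) = cong ((1ℚ , mulW p u y) ∷_) (mulQ-singleton u ys)

  mulQ-sumOf : (xs ys : List (Word p)) →
    mulQ p (sumOf xs) (sumOf ys) ≡ sumOf (concatMap (λ u → map (mulW p u) ys) xs)
  mulQ-sumOf []       ys = refl
  mulQ-sumOf (u ∷ xs) ys = trans
    (cong₂ _++_ (trans (sym (List.++-identityʳ _)) (trans (mulQ-singleton u ys) (List.++-identityʳ _)))
                (mulQ-sumOf xs ys))
    (sym (List.map-++ _ (map (mulW p u) ys) _))

InRange : ℕ → ℕ → Set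
InRange k v = 1 ≤ v × v ≤ k

inRange? : ∀ k v → Dec (InRange k v)
inRange? k v = (1 ℕ.≤? v) ×-dec (v ℕ.≤? k)

≤-suc-≢⇒≤ : ∀ {v k} → v ≢ suc k → v ≤ suc k → v ≤ k
≤-suc-≢⇒≤ v≢k+1 v≤k+1 = ℕ.<⇒≤pred (ℕ.≤∧≢⇒< v≤k+1 v≢k+1)

𝟙-inRange-suc : ∀ {k v} → v ≢ suc k → 𝟙 (inRange? (suc k) v) ≡ 𝟙 (inRange? k v)
𝟙-inRange-suc {k} {v} v≢k+1 = 𝟙-cong (λ (1≤v , v≤k+1) → 1≤v , ≤-suc-≢⇒≤ v≢k+1 v≤k+1)
  (λ (1≤v , v≤k) → 1≤v , ℕ.m≤n⇒m≤1+n v≤k) (inRange? (suc k) v) (inRange? k v)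

count-range1 : ∀ k v → Countℕ.count v (range1 k) ≡ 𝟙 (inRange? k v)
count-range1 zero    v = sym (𝟙-no (λ (1≤v , v≤0) → ℕ.<-irrefl refl (ℕ.<-≤-trans 1≤v v≤0)) (inRange? 0 v))
count-range1 (suc k) v = begin
  Countℕ.count v (range1 (suc k))                     ≡⟨ cong (Countℕ.count v) (List.applyUpTo-∷ʳ suc k) ⟨
  Countℕ.count v (range1 k ++ suc k ∷ [])             ≡⟨ Countℕ.count-++ v (range1 k) _ ⟩
  Countℕ.count v (range1 k) + (𝟙 (suc k ℕ.≟ v) + 0)  ≡⟨ cong₂ _+_ (count-range1 k v) (ℕ.+-identityʳ _) ⟩
  𝟙 (inRange? k v) + 𝟙 (suc k ℕ.≟ v)                 ≡⟨ split (suc k ℕ.≟ v) ⟩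
  𝟙 (inRange? (suc k) v)                              ∎
  where
  open ≡-Reasoning
  split : (d : Dec (suc k ≡ v)) → 𝟙 (inRange? k v) + 𝟙 d ≡ 𝟙 (inRange? (suc k) v)
  split (yes refl) = cong₂ _+_ (𝟙-no (λ (_ , k+1≤k) → ℕ.<-irrefl refl k+1≤k) (inRange? k (suc k)))
                               (sym (𝟙-yes (s≤s z≤n , ℕ.≤-refl) (inRange? (suc k) (suc k))))
  split (no k+1≢v) = trans (ℕ.+-identityʳ _) (sym (𝟙-inRange-suc (k+1≢v ∘ sym)))

Enumerates : ℕ → List ℕ → Set
Enumerates k xs = ∀ v → Countℕ.count v xs ≡ 𝟙 (inRange? k v)

sumMap-count-range1 : ∀ k xs → All (InRange k) xs → sumMap (λ v → Countℕ.count v xs) (range1 k) ≡ length xs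
sumMap-count-range1 k xs inR = begin
  sumMap (λ v → sumMap (λ x → 𝟙 (x ℕ.≟ v)) xs) (range1 k) ≡⟨ sumMap-comm (λ x v → 𝟙 (x ℕ.≟ v)) xs (range1 k) ⟨
  sumMap (λ x → sumMap (λ v → 𝟙 (x ℕ.≟ v)) (range1 k)) xs ≡⟨ sumMap-cong xs (λ x → Countℕ.count-sym x (range1 k)) ⟩
  sumMap (λ x → Countℕ.count x (range1 k)) xs             ≡⟨ sumMap-cong-∈ xs (λ x x∈ → trans (count-range1 k x)
                                                               (𝟙-yes (All.lookup inR x∈) (inRange? k x))) ⟩
  sumMap (λ _ → 1) xs                                      ≡⟨ sumMap-one xs ⟩
  length xs                                                ∎
  where open ≡-Reasoning

range1-inRange : ∀ k → All (InRange k) (range1 k)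
range1-inRange k = All.tabulate (λ {v} v∈ → 𝟙-witness (inRange? k v) (subst (1 ≤_) (count-range1 k v) (Countℕ.count-∈ v∈)))

sumMap-𝟙-inRange : ∀ k → sumMap (λ v → 𝟙 (inRange? k v)) (range1 k) ≡ k
sumMap-𝟙-inRange k = begin
  sumMap (λ v → 𝟙 (inRange? k v)) (range1 k)            ≡⟨ sumMap-cong (range1 k) (λ v → count-range1 k v) ⟨
  sumMap (λ v → Countℕ.count v (range1 k)) (range1 k)   ≡⟨ sumMap-count-range1 k (range1 k) (range1-inRange k) ⟩
  length (range1 k)                                      ≡⟨ List.length-applyUpTo suc k ⟩
  k                                                      ∎
  where open ≡-Reasoning

enumerates⇒inRange : ∀ {k} xs → Enumerates k xs → All (InRange k) xs
enumerates⇒inRange {k} xs enum =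
  All.tabulate (λ {v} v∈ → 𝟙-witness (inRange? k v) (subst (1 ≤_) (enum v) (Countℕ.count-∈ v∈)))

enumerates⇒unique×length×inRange : ∀ {k} xs → Enumerates k xs → Unique xs × length xs ≡ k × All (InRange k) xs
enumerates⇒unique×length×inRange {k} xs enum =
  Countℕ.count≤1⇒unique xs (λ v → subst (_≤ 1) (sym (enum v)) (𝟙≤1 (inRange? k v))) ,
  trans (sym (sumMap-count-range1 k xs inR)) (trans (sumMap-cong (range1 k) enum) (sumMap-𝟙-inRange k)) ,
  inR
  where
  inR = enumerates⇒inRange xs enum

-- Pigeonhole: the counts are pointwise below the indicator of [1..k] and both sum to k.
unique×length×inRange⇒enumerates : ∀ {k} xs → Unique xs → length xs ≡ k → All (InRange k) xs → Enumerates k xs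
unique×length×inRange⇒enumerates {k} xs uniq len inR v = pointwise v (inRange? k v)
  where
  absent : ∀ {u} → ¬ InRange k u → Countℕ.count u xs ≡ 0
  absent u∉ = ℕ.n≤0⇒n≡0 (ℕ.≮⇒≥ (u∉ ∘ All.lookup inR ∘ Countℕ.∈-count xs))
  below : ∀ u → (d : Dec (InRange k u)) → Countℕ.count u xs ≤ 𝟙 d
  below u (yes _)  = Countℕ.unique⇒count≤1 uniq u
  below u (no u∉) = ℕ.≤-reflexive (absent u∉)
  sums≡ : sumMap (λ u → Countℕ.count u xs) (range1 k) ≡ sumMap (λ u → 𝟙 (inRange? k u)) (range1 k)
  sums≡ = trans (sumMap-count-range1 k xs inR) (trans len (sym (sumMap-𝟙-inRange k)))
  pointwise : ∀ u → (d : Dec (InRange k u)) → Countℕ.count u xs ≡ 𝟙 d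
  pointwise u (no u∉) = absent u∉
  pointwise u (yes u∈) = trans
    (sumMap-mono-≡ (range1 k) (λ u _ → below u (inRange? k u)) sums≡ u
      (Countℕ.∈-count (range1 k) (ℕ.≤-reflexive (sym (trans (count-range1 k u) (𝟙-yes u∈ (inRange? k u)))))))
    (𝟙-yes u∈ (inRange? k u))

enumerates? : ∀ k xs → Dec (Enumerates k xs)
enumerates? k xs = map′ (λ (uniq , len , inR) → unique×length×inRange⇒enumerates xs uniq len inR)
  (enumerates⇒unique×length×inRange xs) (unique? xs ×-dec ((length xs ℕ.≟ k) ×-dec All.all? (inRange? k) xs))

count-allFin : ∀ {p} (c : Fin p) → CountFin.count c (allFin p) ≡ 1
count-allFin {p} c = CountFin.count-unique-∈ (Unique.allFin⁺ p) (∈-allFin c)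

module Colour (p : ℕ) .{{_ : NonZero p}} where

  toℕ-mod : ∀ a → toℕ (a mod p) ≡ a % p
  toℕ-mod a = Fin.toℕ-fromℕ< _

  toℕ%p : (c : Fin p) → toℕ c % p ≡ toℕ c
  toℕ%p c = m<n⇒m%n≡m (Fin.toℕ<n c)

  [a+b%p]%p : ∀ a b → (a + b % p) % p ≡ (a + b) % p
  [a+b%p]%p a b = begin
    (a + b % p) % p          ≡⟨ %-distribˡ-+ a (b % p) p ⟩
    (a % p + b % p % p) % p  ≡⟨ cong (λ m → (a % p + m) % p) (m%n%n≡m%n b p) ⟩
    (a % p + b % p) % p      ≡⟨ %-distribˡ-+ a b p ⟨
    (a + b) % p              ∎
    where open ≡-Reasoning

  toℕ-addC : ∀ d c → toℕ (addC p d c) ≡ (toℕ d + toℕ c) % p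
  toℕ-addC d c = toℕ-mod (toℕ d + toℕ c)

  addC-identityʳ : ∀ t → addC p t (c0 p) ≡ t
  addC-identityʳ t = Fin.toℕ-injective (begin
    toℕ (addC p t (c0 p))      ≡⟨ toℕ-addC t (c0 p) ⟩
    (toℕ t + toℕ (c0 p)) % p   ≡⟨ cong (λ m → (toℕ t + m) % p) (toℕ-mod 0) ⟩
    (toℕ t + 0 % p) % p        ≡⟨ [a+b%p]%p (toℕ t) 0 ⟩
    (toℕ t + 0) % p            ≡⟨ cong (_% p) (ℕ.+-identityʳ (toℕ t)) ⟩
    toℕ t % p                  ≡⟨ toℕ%p t ⟩
    toℕ t                      ∎)
    where open ≡-Reasoning

  [a+[b+c]%p]%p : ∀ {a b} c → a + b ≡ p → (a + (b + c) % p) % p ≡ c % p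
  [a+[b+c]%p]%p {a} {b} c a+b≡p = begin
    (a + (b + c) % p) % p   ≡⟨ [a+b%p]%p a (b + c) ⟩
    (a + (b + c)) % p       ≡⟨ cong (_% p) (trans (sym (ℕ.+-assoc a b c)) (trans (cong (_+ c) a+b≡p) (ℕ.+-comm p c))) ⟩
    (c + p) % p             ≡⟨ [m+n]%n≡m%n c p ⟩
    c % p                   ∎
    where open ≡-Reasoning

  subC : Fin p → Fin p → Fin p
  subC e d = ((p ∸ toℕ d) + toℕ e) mod p

  addC-subC : ∀ d e → addC p d (subC e d) ≡ e
  addC-subC d e = Fin.toℕ-injective (begin
    toℕ (addC p d (subC e d))                ≡⟨ toℕ-addC d (subC e d) ⟩
    (toℕ d + toℕ (subC e d)) % p             ≡⟨ cong (λ m → (toℕ d + m) % p) (toℕ-mod _) ⟩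
    (toℕ d + ((p ∸ toℕ d) + toℕ e) % p) % p  ≡⟨ [a+[b+c]%p]%p (toℕ e) (ℕ.m+[n∸m]≡n (ℕ.<⇒≤ (Fin.toℕ<n d))) ⟩
    toℕ e % p                                ≡⟨ toℕ%p e ⟩
    toℕ e                                    ∎)
    where open ≡-Reasoning

  subC-addC : ∀ d c → subC (addC p d c) d ≡ c
  subC-addC d c = Fin.toℕ-injective (begin
    toℕ (subC (addC p d c) d)                ≡⟨ toℕ-mod _ ⟩
    ((p ∸ toℕ d) + toℕ (addC p d c)) % p     ≡⟨ cong (λ m → ((p ∸ toℕ d) + m) % p) (toℕ-addC d c) ⟩
    ((p ∸ toℕ d) + (toℕ d + toℕ c) % p) % p  ≡⟨ [a+[b+c]%p]%p (toℕ c) (ℕ.m∸n+n≡m (ℕ.<⇒≤ (Fin.toℕ<n d))) ⟩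
    toℕ c % p                                ≡⟨ toℕ%p c ⟩
    toℕ c                                    ∎)
    where open ≡-Reasoning

  sumMap-addC≡ : ∀ d e → sumMap (λ c → 𝟙 (addC p d c Fin.≟ e)) (allFin p) ≡ 1
  sumMap-addC≡ d e = begin
    sumMap (λ c → 𝟙 (addC p d c Fin.≟ e)) (allFin p)  ≡⟨ sumMap-cong (allFin p) solve ⟩
    CountFin.count (subC e d) (allFin p)               ≡⟨ count-allFin (subC e d) ⟩
    1                                                  ∎
    where
    open ≡-Reasoning
    solve : ∀ c → 𝟙 (addC p d c Fin.≟ e) ≡ 𝟙 (c Fin.≟ subC e d)
    solve c = 𝟙-cong (λ eq → trans (sym (subC-addC d c)) (cong (λ x → subC x d) eq))
                     (λ c≡ → trans (cong (addC p d) c≡) (addC-subC d e)) (addC p d c Fin.≟ e) (c Fin.≟ subC e d)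

alphabet : ∀ p → ℕ → List (Letter p)
alphabet p k = cartesianProduct (allFin p) (range1 k)

count-alphabet : ∀ {p} k (x : Letter p) → CountLetter.count x (alphabet p k) ≡ 𝟙 (inRange? k (proj₂ x))
count-alphabet {p} k (c , v) = begin
  CountLetter.count (c , v) (alphabet p k)                        ≡⟨ count-cartesianProduct Fin._≟_ ℕ._≟_ c v (allFin p) (range1 k) ⟩
  CountFin.count c (allFin p) * Countℕ.count v (range1 k)        ≡⟨ cong₂ _*_ (count-allFin c) (count-range1 k v) ⟩
  1 * 𝟙 (inRange? k v)                                            ≡⟨ ℕ.*-identityˡ _ ⟩
  𝟙 (inRange? k v)                                                ∎
  where open ≡-Reasoning

vals : ∀ {p} → Word p → List ℕ
vals = map proj₂

count-G : ∀ p .{{_ : NonZero p}} k (w : Word p) → count w (G p k) ≡ 𝟙 (enumerates? k (vals w))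
count-G p k w = begin
  count w (G p k)
    ≡⟨ count-filter (unique? ∘ vals) w (wordsOf (alphabet p k) k) ⟩
  𝟙 (unique? (vals w)) * count w (wordsOf (alphabet p k) k)
    ≡⟨ cong (𝟙 (unique? (vals w)) *_)
            (WordMultiplicity.count-wordsOf _≟L_ (alphabet p k) (inRange? k ∘ proj₂) (count-alphabet k) k w) ⟩
  𝟙 (unique? (vals w)) * 𝟙 shape?
    ≡⟨ 𝟙-× (unique? (vals w)) shape? ⟨
  𝟙 (unique? (vals w) ×-dec shape?)
    ≡⟨ 𝟙-cong (λ (uniq , len , inR) →
                 unique×length×inRange⇒enumerates (vals w) uniq (trans (List.length-map proj₂ w) len) (All.map⁺ inR))
              (λ enum → let (uniq , len , inR) = enumerates⇒unique×length×inRange (vals w) enum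
                        in uniq , trans (sym (List.length-map proj₂ w)) len , All.map⁻ inR)
              (unique? (vals w) ×-dec shape?) (enumerates? k (vals w)) ⟩
  𝟙 (enumerates? k (vals w)) ∎
  where
  open ≡-Reasoning
  shape? = (length w ℕ.≟ k) ×-dec All.all? (inRange? k ∘ proj₂) w

module _ {p : ℕ} where

  Low : ℕ → Pred (Letter p) _
  Low k x = proj₂ x ≤ k

  low? : ∀ k → Decidable (Low k)
  low? k x = proj₂ x ℕ.≤? k

  low high : ℕ → Word p → Word p
  low  k = filter (low? k)
  high k = filter (∁? (low? k))

  Val : ℕ → Pred (Letter p) _
  Val j x = proj₂ x ≡ j

  val? : ∀ j → Decidable (Val j)
  val? j x = proj₂ x ℕ.≟ j

  rest : ℕ → Word p → Word p
  rest j = filter (∁? (val? j))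

  count-vals : ∀ j (w : Word p) → Countℕ.count j (vals w) ≡ length (filter (val? j) w)
  count-vals j []      = refl
  count-vals j (x ∷ w) = by (val? j x)
    where
    by : Dec (Val j x) → 𝟙 (proj₂ x ℕ.≟ j) + Countℕ.count j (vals w) ≡ length (filter (val? j) (x ∷ w))
    by (yes x∈) = trans (cong₂ _+_ (𝟙-yes x∈ (val? j x)) (count-vals j w))
                        (cong length (sym (List.filter-accept (val? j) x∈)))
    by (no x∉)  = trans (cong₂ _+_ (𝟙-no x∉ (val? j x)) (count-vals j w))
                        (cong length (sym (List.filter-reject (val? j) x∉)))

  count-vals-filter : ∀ {Q : Pred ℕ ℓ} (Q? : Decidable Q) v (w : Word p) →
    Countℕ.count v (vals (filter (Q? ∘ proj₂) w)) ≡ 𝟙 (Q? v) * Countℕ.count v (vals w)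
  count-vals-filter Q? v w = trans (cong (Countℕ.count v) (map-filter proj₂ Q? w)) (Countℕ.count-filter Q? v (vals w))

  count-vals≡0⇒∁Val : ∀ j (u : Word p) → Countℕ.count j (vals u) ≡ 0 → All (∁ (Val j)) u
  count-vals≡0⇒∁Val j u none = All.map (_∘ sym) (All.map⁻ (Countℕ.count≡0⇒all≢ (vals u) none))

  count-low : ∀ k v (w : Word p) → Countℕ.count v (vals (low k w)) ≡ 𝟙 (v ℕ.≤? k) * Countℕ.count v (vals w)
  count-low k = count-vals-filter (ℕ._≤? k)

  count-low-≤ : ∀ {k v} (w : Word p) → v ≤ k → Countℕ.count v (vals (low k w)) ≡ Countℕ.count v (vals w)
  count-low-≤ {k} {v} w v≤k = trans (count-low k v w) (𝟙*-yes v≤k (v ℕ.≤? k) _)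

  count-high-> : ∀ {k v} (w : Word p) → k < v → Countℕ.count v (vals (high k w)) ≡ Countℕ.count v (vals w)
  count-high-> {k} {v} w k<v = trans (count-vals-filter (λ v → ¬? (v ℕ.≤? k)) v w) (𝟙*-yes (ℕ.<⇒≱ k<v) (¬? (v ℕ.≤? k)) _)

  count-low-suc : ∀ {k v} (w : Word p) → v ≢ suc k →
    Countℕ.count v (vals (low (suc k) w)) ≡ Countℕ.count v (vals (low k w))
  count-low-suc {k} {v} w v≢k+1 = trans (count-low (suc k) v w) (trans
    (cong (_* Countℕ.count v (vals w)) (𝟙-cong (≤-suc-≢⇒≤ v≢k+1) ℕ.m≤n⇒m≤1+n (v ℕ.≤? suc k) (v ℕ.≤? k)))
    (sym (count-low k v w)))

  count-rest-≢ : ∀ {j v} (w : Word p) → v ≢ j → Countℕ.count v (vals (rest j w)) ≡ Countℕ.count v (vals w)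
  count-rest-≢ {j} {v} w v≢j = trans (count-vals-filter (λ v → ¬? (v ℕ.≟ j)) v w) (𝟙*-yes v≢j (¬? (v ℕ.≟ j)) _)

  count-rest-self : ∀ j (w : Word p) → Countℕ.count j (vals (rest j w)) ≡ 0
  count-rest-self j w = trans (count-vals-filter (λ v → ¬? (v ℕ.≟ j)) j w) (𝟙*-no (λ j≢j → j≢j refl) (¬? (j ℕ.≟ j)) _)

  count-low-rest-≢ : ∀ {k j v} (w : Word p) → v ≢ j →
    Countℕ.count v (vals (low k (rest j w))) ≡ Countℕ.count v (vals (low k w))
  count-low-rest-≢ {k} {j} {v} w v≢j =
    trans (count-low k v (rest j w)) (trans (cong (𝟙 (v ℕ.≤? k) *_) (count-rest-≢ w v≢j)) (sym (count-low k v w)))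

  count-low-rest-self : ∀ k j (w : Word p) → Countℕ.count j (vals (low k (rest j w))) ≡ 0
  count-low-rest-self k j w =
    trans (count-low k j (rest j w)) (trans (cong (𝟙 (j ℕ.≤? k) *_) (count-rest-self j w)) (ℕ.*-zeroʳ (𝟙 (j ℕ.≤? k))))

module _ (p : ℕ) .{{_ : NonZero p}} where

  Wkn-self : ∀ k → Wkn p k k ≡ []
  Wkn-self k = cong (applyUpTo _) (ℕ.n∸n≡0 k)

  Wkn-∷ : ∀ {k n} → k < n → Wkn p k n ≡ (c0 p , suc k) ∷ Wkn p (suc k) n
  Wkn-∷ {k} {suc n} (s≤s k≤n) = begin
    applyUpTo (λ i → c0 p , suc (k + i)) (suc n ∸ k)     ≡⟨ cong (applyUpTo _) (ℕ.+-∸-assoc 1 k≤n) ⟩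
    applyUpTo (λ i → c0 p , suc (k + i)) (suc (n ∸ k))   ≡⟨ cong₂ _∷_ (cong (λ m → c0 p , suc m) (ℕ.+-identityʳ k))
                                                              (applyUpTo-cong (λ i → cong (λ m → c0 p , suc m) (ℕ.+-suc k i)) (n ∸ k)) ⟩
    (c0 p , suc k) ∷ Wkn p (suc k) (suc n)               ∎
    where open ≡-Reasoning

  Wkn-high : ∀ k n → All (∁ (Low k)) (Wkn p k n)
  Wkn-high k n = All.applyUpTo⁺₂ _ (n ∸ k) (λ i → ℕ.<⇒≱ (s≤s (ℕ.m≤m+n k i)))

  G-low : ∀ k α → α ∈ G p k → All (Low k) α
  G-low k α α∈ = All.map proj₂ (All.map⁻ (proj₂ (proj₂ (enumerates⇒unique×length×inRange (vals α) enum))))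
    where
    enum = 𝟙-witness (enumerates? k (vals α)) (subst (1 ≤_) (count-G p k α) (count-∈ α∈))

  shuffles : ℕ → ℕ → List (Word p)
  shuffles n k = concatMap (λ α → shuffle α (Wkn p k n)) (G p k)

  Bterms-shuffles : ∀ {n k} → k ≤ n → Bterms p n k ≡ shuffles n k
  Bterms-shuffles {n} {k} k≤n with ℕ.m≤n⇒m<n∨m≡n k≤n
  ... | inj₁ k<n  = cong (if_then shuffles n k else G p n) (Equivalence.to T-≡ (ℕ.<⇒<ᵇ k<n))
  ... | inj₂ refl = begin
    Bterms p k k                                     ≡⟨ cong (if_then shuffles k k else G p k) (<ᵇ-irrefl k) ⟩
    G p k                                            ≡⟨ List.concatMap-pure (G p k) ⟨
    concatMap (_∷ []) (G p k)                        ≡⟨ List.concatMap-cong shuffle-Wkk (G p k) ⟩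
    shuffles k k                                     ∎
    where
    open ≡-Reasoning
    shuffle-Wkk : ∀ α → α ∷ [] ≡ shuffle α (Wkn p k k)
    shuffle-Wkk α = trans (sym (shuffle-[] α)) (cong (shuffle α) (sym (Wkn-self k)))

  InB : ℕ → ℕ → Word p → Set
  InB n k w = high k w ≡ Wkn p k n × Enumerates k (vals (low k w))

  inB? : ∀ n k w → Dec (InB n k w)
  inB? n k w = (high k w ≟W Wkn p k n) ×-dec enumerates? k (vals (low k w))

  count-Bterms : ∀ {n k} → k ≤ n → ∀ w → count w (Bterms p n k) ≡ 𝟙 (inB? n k w)
  count-Bterms {n} {k} k≤n w = begin
    count w (Bterms p n k)
      ≡⟨ cong (count w) (Bterms-shuffles k≤n) ⟩
    count w (shuffles n k)
      ≡⟨ count-concatMap w (λ α → shuffle α W) (G p k) ⟩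
    sumMap (λ α → count w (shuffle α W)) (G p k)
      ≡⟨ sumMap-cong-∈ (G p k) (λ α α∈ → count-shuffle (low? k) α W w (G-low k α α∈) (Wkn-high k n)) ⟩
    sumMap (λ α → 𝟙 (splits? (low? k) α W w)) (G p k)
      ≡⟨ sumMap-cong (G p k) (λ α → trans (𝟙-× (low k w ≟W α) high?) (ℕ.*-comm _ (𝟙 high?))) ⟩
    sumMap (λ α → 𝟙 high? * 𝟙 (low k w ≟W α)) (G p k)
      ≡⟨ sumMap-*ˡ (𝟙 high?) (λ α → 𝟙 (low k w ≟W α)) (G p k) ⟩
    𝟙 high? * sumMap (λ α → 𝟙 (low k w ≟W α)) (G p k)
      ≡⟨ cong (𝟙 high? *_) (trans (count-sym (low k w) (G p k)) (count-G p k (low k w))) ⟩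
    𝟙 high? * 𝟙 (enumerates? k (vals (low k w)))
      ≡⟨ 𝟙-× high? (enumerates? k (vals (low k w))) ⟨
    𝟙 (inB? n k w) ∎
    where
    open ≡-Reasoning
    open WordMultiplicity _≟L_ using (count-shuffle; splits?)
    W = Wkn p k n
    high? = high k w ≟W W

  InB-count≥1 : ∀ {n k} → k ≤ n → ∀ {w} → 1 ≤ count w (Bterms p n k) → InB n k w
  InB-count≥1 k≤n {w} w∈ = 𝟙-witness (inB? _ _ w) (subst (1 ≤_) (count-Bterms k≤n w) w∈)

  length-InB : ∀ {n k} → k ≤ n → ∀ {w} → InB n k w → length w ≡ n
  length-InB {n} {k} k≤n {w} (high≡ , enum) = begin
    length w                               ≡⟨ length-filter-∁ (low? k) w ⟨
    length (low k w) + length (high k w)   ≡⟨ cong₂ _+_ low-length high-length ⟩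
    k + (n ∸ k)                            ≡⟨ ℕ.m+[n∸m]≡n k≤n ⟩
    n                                      ∎
    where
    open ≡-Reasoning
    low-length : length (low k w) ≡ k
    low-length = trans (sym (List.length-map proj₂ (low k w)))
                       (proj₁ (proj₂ (enumerates⇒unique×length×inRange (vals (low k w)) enum)))
    high-length : length (high k w) ≡ n ∸ k
    high-length = trans (cong length high≡) (List.length-applyUpTo _ (n ∸ k))

  head∈heads-once : ∀ {n k} → k < n → ∀ {w} → InB n k w → sumMap (λ t → 𝟙 (T? (headIs t w))) (heads p k) ≡ 1
  head∈heads-once {n} {k} k<n {[]} (high≡ , _) with () ← trans high≡ (Wkn-∷ k<n)
  head∈heads-once {n} {k} k<n {x ∷ w} (high≡ , enum) = begin
    sumMap (λ t → 𝟙 (x ≟L t)) (heads p k)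
      ≡⟨ CountLetter.count-sym x (heads p k) ⟩
    CountLetter.count x (alphabet p k ++ top ∷ [])
      ≡⟨ CountLetter.count-++ x (alphabet p k) (top ∷ []) ⟩
    CountLetter.count x (alphabet p k) + (𝟙 (top ≟L x) + 0)
      ≡⟨ cong₂ _+_ (count-alphabet k x) (ℕ.+-identityʳ _) ⟩
    𝟙 (inRange? k (proj₂ x)) + 𝟙 (top ≟L x)
      ≡⟨ by (low? k x) ⟩
    1 ∎
    where
    open ≡-Reasoning
    top = (c0 p , suc k)
    by : Dec (Low k x) → 𝟙 (inRange? k (proj₂ x)) + 𝟙 (top ≟L x) ≡ 1
    by (yes x≤k) = cong₂ _+_ (𝟙-yes x-inRange (inRange? k (proj₂ x)))
                             (𝟙-no (λ top≡x → ℕ.<⇒≱ ℕ.≤-refl (subst (_≤ k) (cong proj₂ (sym top≡x)) x≤k)) (top ≟L x))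
      where
      x-inRange : InRange k (proj₂ x)
      x-inRange = 𝟙-witness (inRange? k (proj₂ x)) (subst (1 ≤_) (enum (proj₂ x))
        (Countℕ.count-∈ (subst (proj₂ x ∈_) (cong vals (sym (List.filter-accept (low? k) x≤k))) (here refl))))
    by (no x≰k) = cong₂ _+_ (𝟙-no (x≰k ∘ proj₂) (inRange? k (proj₂ x))) (𝟙-yes (sym x≡top) (top ≟L x))
      where
      x≡top : x ≡ top
      x≡top = List.∷-injectiveˡ (trans (sym (List.filter-accept (∁? (low? k)) x≰k)) (trans high≡ (Wkn-∷ k<n)))

  count-byHead : ∀ {n k} → k < n → ∀ w →
    count w (concatMap (λ t → filterᵇ (headIs t) (Bterms p n k)) (heads p k)) ≡ count w (Bterms p n k)
  count-byHead {n} {k} k<n w = begin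
    count w (concatMap byHead (heads p k))                        ≡⟨ count-concatMap w byHead (heads p k) ⟩
    sumMap (λ t → count w (byHead t)) (heads p k)                 ≡⟨ sumMap-cong (heads p k) (λ t → count-filter (T? ∘ headIs t) w Bk) ⟩
    sumMap (λ t → 𝟙 (T? (headIs t w)) * count w Bk) (heads p k)   ≡⟨ sumMap-*ʳ (count w Bk) (λ t → 𝟙 (T? (headIs t w))) (heads p k) ⟩
    headCount * count w Bk                                        ≡⟨ by-multiplicity (count w Bk) refl ⟩
    count w Bk                                                    ∎
    where
    open ≡-Reasoning
    Bk = Bterms p n k
    byHead : Letter p → List (Word p)
    byHead t = filterᵇ (headIs t) Bk
    headCount = sumMap (λ t → 𝟙 (T? (headIs t w))) (heads p k)
    by-multiplicity : ∀ m → m ≡ count w Bk → headCount * m ≡ m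
    by-multiplicity zero    _  = ℕ.*-zeroʳ headCount
    by-multiplicity (suc m) eq = trans
      (cong (_* suc m) (head∈heads-once k<n {w} (InB-count≥1 (ℕ.<⇒≤ k<n) (subst (1 ≤_) eq (s≤s z≤n)))))
      (ℕ.*-identityˡ (suc m))

  B≈sumC : ∀ {n k} → k < n → B p n k ≈ sumC p n k
  B≈sumC {n} {k} k<n w = trans
    (sumOf-cong (Bterms p n k) (concatMap byHead (heads p k)) (sym ∘ count-byHead k<n) w)
    (cong (λ xs → coeff xs w) (sym (concatMap-sumOf byHead (heads p k))))
    where
    byHead : Letter p → List (Word p)
    byHead t = filterᵇ (headIs t) (Bterms p n k)

module Product (p : ℕ) .{{_ : NonZero p}} where

  open Colour p

  -- mulW p u acts letterwise by a function local to its definition; act recovers it.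
  act : Word p → Letter p → Letter p
  act u x with mulW p u (x ∷ [])
  ... | y ∷ _ = y
  ... | []    = x

  mulW-act : ∀ u v → mulW p u v ≡ map (act u) v
  mulW-act u []      = refl
  mulW-act u (x ∷ v) = cong (_ ∷_) (mulW-act u v)

  act-at : ∀ u s j {t m} → at u (j ∸ 1) ≡ just (t , m) → act u (s , j) ≡ (addC p t s , m)
  act-at u s j eq rewrite eq = refl

  mulW-Wkn₁ : ∀ n t u → length u ≡ n ∸ 1 → mulW p (t ∷ u) (Wkn p 1 n) ≡ u
  mulW-Wkn₁ n t u len = begin
    mulW p (t ∷ u) (Wkn p 1 n)                                  ≡⟨ mulW-act (t ∷ u) _ ⟩
    map (act (t ∷ u)) (applyUpTo (λ i → c0 p , suc (suc i)) (n ∸ 1)) ≡⟨ List.map-applyUpTo _ (act (t ∷ u)) (n ∸ 1) ⟩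
    applyUpTo (λ i → act (t ∷ u) (c0 p , suc (suc i))) (n ∸ 1)  ≡⟨ cong (applyUpTo _) (sym len) ⟩
    applyUpTo (λ i → act (t ∷ u) (c0 p , suc (suc i))) (length u) ≡⟨ applyUpTo-at u _ act≡ ⟩
    u                                                           ∎
    where
    open ≡-Reasoning
    act≡ : ∀ i x → at u i ≡ just x → act (t ∷ u) (c0 p , suc (suc i)) ≡ x
    act≡ i (c , v) eq = trans (act-at (t ∷ u) (c0 p) (suc (suc i)) eq) (cong (_, v) (addC-identityʳ c))

  G₁ : G p 1 ≡ map (λ c → (c , 1) ∷ []) (allFin p)
  G₁ = singletons (allFin p)
    where
    singletons : ∀ cs → filter (unique? ∘ vals) (wordsOf (cartesianProduct cs (1 ∷ [])) 1) ≡ map (λ c → (c , 1) ∷ []) cs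
    singletons []       = refl
    singletons (c ∷ cs) = cong (((c , 1) ∷ []) ∷_) (singletons cs)

  Bterms₁ : ∀ {n} → 1 < n → Bterms p n 1 ≡ concatMap (λ c → shuffle ((c , 1) ∷ []) (Wkn p 1 n)) (allFin p)
  Bterms₁ 1<n = trans (Bterms-shuffles p (ℕ.<⇒≤ 1<n))
    (trans (cong (concatMap _) G₁) (List.concatMap-map _ (λ c → (c , 1) ∷ []) (allFin p)))

  mulW-shuffle₁ : ∀ n d j u c → length u ≡ n ∸ 1 →
    map (mulW p ((d , j) ∷ u)) (shuffle ((c , 1) ∷ []) (Wkn p 1 n)) ≡ shuffle ((addC p d c , j) ∷ []) u
  mulW-shuffle₁ n d j u c len = begin
    map (mulW p t∷u) (shuffle ((c , 1) ∷ []) (Wkn p 1 n))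
      ≡⟨ List.map-cong (mulW-act t∷u) (shuffle ((c , 1) ∷ []) (Wkn p 1 n)) ⟩
    map (map (act t∷u)) (shuffle ((c , 1) ∷ []) (Wkn p 1 n))
      ≡⟨ map-shuffle (act t∷u) ((c , 1) ∷ []) (Wkn p 1 n) ⟩
    shuffle ((addC p d c , j) ∷ []) (map (act t∷u) (Wkn p 1 n))
      ≡⟨ cong (shuffle ((addC p d c , j) ∷ [])) (trans (sym (mulW-act t∷u (Wkn p 1 n))) (mulW-Wkn₁ n (d , j) u len)) ⟩
    shuffle ((addC p d c , j) ∷ []) u ∎
    where
    open ≡-Reasoning
    t∷u = (d , j) ∷ u

  sumMap-singleton : ∀ d j (L : Word p) → All (Val j) L →
    sumMap (λ c → 𝟙 (L ≟W ((addC p d c , j) ∷ []))) (allFin p) ≡ 𝟙 (length L ℕ.≟ 1)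
  sumMap-singleton d j []                  _            = sumMap-zero (allFin p)
  sumMap-singleton d j ((e , j) ∷ [])      (refl ∷ [])  = begin
    sumMap (λ c → 𝟙 (((e , j) ∷ []) ≟W ((addC p d c , j) ∷ []))) (allFin p)  ≡⟨ sumMap-cong (allFin p) colour ⟩
    sumMap (λ c → 𝟙 (addC p d c Fin.≟ e)) (allFin p)                         ≡⟨ sumMap-addC≡ d e ⟩
    1                                                                        ∎
    where
    open ≡-Reasoning
    colour : ∀ c → 𝟙 (((e , j) ∷ []) ≟W ((addC p d c , j) ∷ [])) ≡ 𝟙 (addC p d c Fin.≟ e)
    colour c = 𝟙-cong (λ eq → sym (cong proj₁ (List.∷-injectiveˡ eq))) (λ eq → cong (λ a → (a , j) ∷ []) (sym eq))
                      (((e , j) ∷ []) ≟W ((addC p d c , j) ∷ [])) (addC p d c Fin.≟ e)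
  sumMap-singleton d j (x ∷ y ∷ L) _ = trans
    (sumMap-cong (allFin p) (λ c → 𝟙-no (λ eq → case List.∷-injectiveʳ eq of λ ()) ((x ∷ y ∷ L) ≟W ((addC p d c , j) ∷ []))))
    (sumMap-zero (allFin p))

  count-mulW-B₁ : ∀ {n} → 1 < n → ∀ d j u → length u ≡ n ∸ 1 → All (∁ (Val j)) u → ∀ w →
    count w (map (mulW p ((d , j) ∷ u)) (Bterms p n 1)) ≡ 𝟙 (Countℕ.count j (vals w) ℕ.≟ 1) * 𝟙 (rest j w ≟W u)
  count-mulW-B₁ {n} 1<n d j u len j∉u w = begin
    count w (map (mulW p t∷u) (Bterms p n 1))
      ≡⟨ cong (count w ∘ map (mulW p t∷u)) (Bterms₁ 1<n) ⟩
    count w (map (mulW p t∷u) (concatMap (λ c → shuffle ((c , 1) ∷ []) W₁) (allFin p)))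
      ≡⟨ cong (count w) (List.map-concatMap (mulW p t∷u) _ (allFin p)) ⟩
    count w (concatMap (λ c → map (mulW p t∷u) (shuffle ((c , 1) ∷ []) W₁)) (allFin p))
      ≡⟨ count-concatMap w _ (allFin p) ⟩
    sumMap (λ c → count w (map (mulW p t∷u) (shuffle ((c , 1) ∷ []) W₁))) (allFin p)
      ≡⟨ sumMap-cong (allFin p) (λ c → cong (count w) (mulW-shuffle₁ n d j u c len)) ⟩
    sumMap (λ c → count w (shuffle ((addC p d c , j) ∷ []) u)) (allFin p)
      ≡⟨ sumMap-cong (allFin p) (λ c → trans (count-shuffle (val? j) _ u w (refl ∷ []) j∉u) (𝟙-× (only c) rest?)) ⟩
    sumMap (λ c → 𝟙 (only c) * 𝟙 rest?) (allFin p)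
      ≡⟨ sumMap-*ʳ (𝟙 rest?) (λ c → 𝟙 (only c)) (allFin p) ⟩
    sumMap (λ c → 𝟙 (only c)) (allFin p) * 𝟙 rest?
      ≡⟨ cong (_* 𝟙 rest?) (sumMap-singleton d j (filter (val? j) w) (All.all-filter (val? j) w)) ⟩
    𝟙 (length (filter (val? j) w) ℕ.≟ 1) * 𝟙 rest?
      ≡⟨ cong (_* 𝟙 rest?) (𝟙-cong (trans (count-vals j w)) (trans (sym (count-vals j w)))
                                           (length (filter (val? j) w) ℕ.≟ 1) (Countℕ.count j (vals w) ℕ.≟ 1)) ⟩
    𝟙 (Countℕ.count j (vals w) ℕ.≟ 1) * 𝟙 rest? ∎
    where
    open ≡-Reasoning
    open WordMultiplicity _≟L_ using (count-shuffle)
    t∷u = (d , j) ∷ u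
    W₁ = Wkn p 1 n
    only : (c : Fin p) → Dec (filter (val? j) w ≡ (addC p d c , j) ∷ [])
    only c = filter (val? j) w ≟W ((addC p d c , j) ∷ [])
    rest? = rest j w ≟W u

  count-byHead·B₁ : ∀ {n k} → k ≤ n → 1 < n → ∀ d j →
    (∀ {u} → InB p n k ((d , j) ∷ u) → All (∁ (Val j)) u) → ∀ w →
    count w (concatMap (λ u → map (mulW p u) (Bterms p n 1)) (filterᵇ (headIs (d , j)) (Bterms p n k)))
      ≡ 𝟙 (Countℕ.count j (vals w) ℕ.≟ 1) * count ((d , j) ∷ rest j w) (Bterms p n k)
  count-byHead·B₁ {n} {k} k≤n 1<n d j tail-avoids w = begin
    count w (concatMap (λ u → map (mulW p u) B₁) (filterᵇ (headIs t) Bk))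
      ≡⟨ count-concatMap w _ (filterᵇ (headIs t) Bk) ⟩
    sumMap (λ u → count w (map (mulW p u) B₁)) (filterᵇ (headIs t) Bk)
      ≡⟨ sumMap-filter (T? ∘ headIs t) _ Bk ⟩
    sumMap (λ u → 𝟙 (T? (headIs t u)) * count w (map (mulW p u) B₁)) Bk
      ≡⟨ sumMap-cong-∈ Bk (λ u u∈ → term u (InB-count≥1 p k≤n (count-∈ u∈))) ⟩
    sumMap (λ u → 𝟙 once? * 𝟙 (u ≟W (t ∷ rest j w))) Bk
      ≡⟨ sumMap-*ˡ (𝟙 once?) _ Bk ⟩
    𝟙 once? * count (t ∷ rest j w) Bk ∎
    where
    open ≡-Reasoning
    t = (d , j)
    Bk = Bterms p n k
    B₁ = Bterms p n 1
    once? = Countℕ.count j (vals w) ℕ.≟ 1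
    term : ∀ u → InB p n k u → 𝟙 (T? (headIs t u)) * count w (map (mulW p u) B₁) ≡ 𝟙 once? * 𝟙 (u ≟W (t ∷ rest j w))
    term []       _  = sym (ℕ.*-zeroʳ (𝟙 once?))
    term (x ∷ u) x∷u∈B = by (x ≟L t)
      where
      by : (x≟t : Dec (x ≡ t)) → 𝟙 x≟t * count w (map (mulW p (x ∷ u)) B₁) ≡ 𝟙 once? * 𝟙 ((x ∷ u) ≟W (t ∷ rest j w))
      by (no x≢t)  = sym (trans (cong (𝟙 once? *_) (𝟙-no (x≢t ∘ List.∷-injectiveˡ) ((x ∷ u) ≟W (t ∷ rest j w))))
                                (ℕ.*-zeroʳ (𝟙 once?)))
      by (yes refl) = trans (ℕ.+-identityʳ _) (trans
        (count-mulW-B₁ 1<n d j u (cong pred (length-InB p k≤n {t ∷ u} x∷u∈B)) (tail-avoids x∷u∈B) w)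
        (cong (𝟙 once? *_) (𝟙-cong (λ { refl → refl }) (sym ∘ List.∷-injectiveʳ) (rest j w ≟W u) ((t ∷ u) ≟W (t ∷ rest j w)))))

pointwise-split : ∀ {f g f′ g′ : ℕ → ℕ} j →
  (∀ v → v ≢ j → f v ≡ f′ v) → (∀ v → v ≢ j → g v ≡ g′ v) → f′ j ≡ g′ j →
  (f j ≡ g j × (∀ v → f′ v ≡ g′ v)) ⇔ (∀ v → f v ≡ g v)
pointwise-split {f} {g} {f′} {g′} j f≈ g≈ at-j = mk⇔
  (λ (fj , eq′) v → case v ℕ.≟ j of λ { (yes refl) → fj ; (no v≢j) → trans (f≈ v v≢j) (trans (eq′ v) (sym (g≈ v v≢j))) })
  (λ eq → eq j , λ v → case v ℕ.≟ j of λ { (yes refl) → at-j ; (no v≢j) → trans (sym (f≈ v v≢j)) (trans (eq v) (g≈ v v≢j)) })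

module _ (p : ℕ) .{{_ : NonZero p}} where

  InB-rest-low : ∀ {n k j} d → 1 ≤ j → j ≤ k → ∀ w →
    (Countℕ.count j (vals w) ≡ 1 × InB p n k ((d , j) ∷ rest j w)) ⇔ InB p n k w
  InB-rest-low {n} {k} {j} d 1≤j j≤k w = mk⇔
    (λ (once , high≡ , enum) → trans (sym highs≡) high≡ , Equivalence.to split (trans count-j (trans once (sym j∈)) , enum))
    (λ (high≡ , enum) → let (fj , enum′) = Equivalence.from split enum in
       trans (sym count-j) (trans fj j∈) , trans highs≡ high≡ , enum′)
    where
    t = (d , j)
    j∈ : 𝟙 (inRange? k j) ≡ 1
    j∈ = 𝟙-yes (1≤j , j≤k) (inRange? k j)
    count-j : Countℕ.count j (vals (low k w)) ≡ Countℕ.count j (vals w)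
    count-j = count-low-≤ w j≤k
    highs≡ : high k (t ∷ rest j w) ≡ high k w
    highs≡ = trans (List.filter-reject (∁? (low? k)) (λ j≰k → j≰k j≤k))
      (filter-filter (∁? (val? j)) (∁? (low? k)) (∁? (low? k)) (λ x≰k → x≰k , λ { refl → x≰k j≤k }) (λ x≰k _ → x≰k) w)
    lows≡ : vals (low k (t ∷ rest j w)) ≡ j ∷ vals (low k (rest j w))
    lows≡ = cong vals (List.filter-accept (low? k) j≤k)
    split = pointwise-split {f = λ v → Countℕ.count v (vals (low k w))} {g = λ v → 𝟙 (inRange? k v)}
                            {f′ = λ v → Countℕ.count v (vals (low k (t ∷ rest j w)))} {g′ = λ v → 𝟙 (inRange? k v)} j
      (λ v v≢j → sym (trans (cong (Countℕ.count v) lows≡)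
        (trans (cong (_+ Countℕ.count v (vals (low k (rest j w)))) (𝟙-no (v≢j ∘ sym) (j ℕ.≟ v))) (count-low-rest-≢ w v≢j))))
      (λ _ _ → refl)
      (trans (cong (Countℕ.count j) lows≡) (trans (cong₂ _+_ (𝟙-yes refl (j ℕ.≟ j)) (count-low-rest-self k j w)) (sym j∈)))

  InB-rest-top : ∀ {n k} → k < n → ∀ w →
    (Countℕ.count (suc k) (vals w) ≡ 1 × InB p n k ((c0 p , suc k) ∷ rest (suc k) w)) ⇔ InB p n (suc k) w
  InB-rest-top {n} {k} k<n w = mk⇔
    (λ (once , high≡ , enum) → List.∷-injectiveʳ (trans (sym highs≡) (trans high≡ (Wkn-∷ p k<n))) ,
                               Equivalence.to split (trans count-top (trans once (sym top∈)) , enum))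
    (λ (high≡ , enum) → let (fk , enum′) = Equivalence.from split enum in
       trans (sym count-top) (trans fk top∈) , trans highs≡ (trans (cong (t ∷_) high≡) (sym (Wkn-∷ p k<n))) , enum′)
    where
    t = (c0 p , suc k)
    k+1≰k : ¬ suc k ≤ k
    k+1≰k = ℕ.<-irrefl refl
    top∈ : 𝟙 (inRange? (suc k) (suc k)) ≡ 1
    top∈ = 𝟙-yes (s≤s z≤n , ℕ.≤-refl) (inRange? (suc k) (suc k))
    count-top : Countℕ.count (suc k) (vals (low (suc k) w)) ≡ Countℕ.count (suc k) (vals w)
    count-top = count-low-≤ w ℕ.≤-refl
    highs≡ : high k (t ∷ rest (suc k) w) ≡ t ∷ high (suc k) w
    highs≡ = trans (List.filter-accept (∁? (low? k)) k+1≰k) (cong (t ∷_)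
      (filter-filter (∁? (val? (suc k))) (∁? (low? k)) (∁? (low? (suc k)))
        (λ x≰k+1 → (x≰k+1 ∘ ℕ.m≤n⇒m≤1+n) , λ { refl → x≰k+1 ℕ.≤-refl })
        (λ x≰k x≢k+1 x≤k+1 → x≰k (≤-suc-≢⇒≤ x≢k+1 x≤k+1)) w))
    lows≡ : low k (t ∷ rest (suc k) w) ≡ low k (rest (suc k) w)
    lows≡ = List.filter-reject (low? k) k+1≰k
    split = pointwise-split {f = λ v → Countℕ.count v (vals (low (suc k) w))} {g = λ v → 𝟙 (inRange? (suc k) v)}
                            {f′ = λ v → Countℕ.count v (vals (low k (t ∷ rest (suc k) w)))} {g′ = λ v → 𝟙 (inRange? k v)} (suc k)
      (λ v v≢k+1 → trans (count-low-suc w v≢k+1) (sym (trans (cong (Countℕ.count v ∘ vals) lows≡) (count-low-rest-≢ w v≢k+1))))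
      (λ v v≢k+1 → 𝟙-inRange-suc v≢k+1)
      (trans (cong (Countℕ.count (suc k) ∘ vals) lows≡)
        (trans (count-low-rest-self k (suc k) w) (sym (𝟙-no (k+1≰k ∘ proj₂) (inRange? k (suc k))))))

  tail-avoids-low : ∀ {n k j d u} → j ≤ k → InB p n k ((d , j) ∷ u) → All (∁ (Val j)) u
  tail-avoids-low {k = k} {j} {u = u} j≤k (_ , enum) = count-vals≡0⇒∁Val j u (begin
    Countℕ.count j (vals u)          ≡⟨ count-low-≤ u j≤k ⟨
    Countℕ.count j (vals (low k u))  ≡⟨ ℕ.n≤0⇒n≡0 (ℕ.+-cancelˡ-≤ 1 _ 0 (subst (_≤ 1) (sym occurs) (𝟙≤1 (inRange? k j)))) ⟩
    0                                ∎)
    where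
    open ≡-Reasoning
    occurs : 1 + Countℕ.count j (vals (low k u)) ≡ 𝟙 (inRange? k j)
    occurs = trans (cong (_+ Countℕ.count j (vals (low k u))) (sym (𝟙-yes refl (j ℕ.≟ j))))
      (trans (cong (Countℕ.count j ∘ vals) (sym (List.filter-accept (low? k) j≤k))) (enum j))

  tail-avoids-top : ∀ {n k u} → k < n → InB p n k ((c0 p , suc k) ∷ u) → All (∁ (Val (suc k))) u
  tail-avoids-top {n} {k} {u} k<n (high≡ , _) = count-vals≡0⇒∁Val (suc k) u (begin
    Countℕ.count (suc k) (vals u)                  ≡⟨ count-high-> u ℕ.≤-refl ⟨
    Countℕ.count (suc k) (vals (high k u))         ≡⟨ cong (Countℕ.count (suc k) ∘ vals) high-u ⟩
    Countℕ.count (suc k) (vals (Wkn p (suc k) n))  ≡⟨ Countℕ.count-all≢ _ (All.map⁺ (All.map (λ x≰k+1 eq → x≰k+1 (ℕ.≤-reflexive (sym eq)))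
                                                                                          (Wkn-high p (suc k) n))) ⟩
    0                                              ∎)
    where
    open ≡-Reasoning
    high-u : high k u ≡ Wkn p (suc k) n
    high-u = List.∷-injectiveʳ (trans (sym (List.filter-accept (∁? (low? k)) (ℕ.<-irrefl refl))) (trans high≡ (Wkn-∷ p k<n)))

  C·B₁≈B : ∀ {n k k′} → k ≤ n → k′ ≤ n → 1 < n → ∀ d j →
    (∀ {u} → InB p n k ((d , j) ∷ u) → All (∁ (Val j)) u) →
    (∀ w → (Countℕ.count j (vals w) ≡ 1 × InB p n k ((d , j) ∷ rest j w)) ⇔ InB p n k′ w) →
    mulQ p (C p n k (d , j)) (B p n 1) ≈ B p n k′
  C·B₁≈B {n} {k} {k′} k≤n k′≤n 1<n d j tail-avoids equiv w = trans
    (cong (λ xs → coeff xs w) (mulQ-sumOf p (filterᵇ (headIs t) Bk) (Bterms p n 1)))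
    (sumOf-cong products (Bterms p n k′) count≡ w)
    where
    open Product p
    t = (d , j)
    Bk = Bterms p n k
    products = concatMap (λ u → map (mulW p u) (Bterms p n 1)) (filterᵇ (headIs t) Bk)
    count≡ : ∀ v → count v products ≡ count v (Bterms p n k′)
    count≡ v = begin
      count v products                             ≡⟨ count-byHead·B₁ k≤n 1<n d j tail-avoids v ⟩
      𝟙 once? * count (t ∷ rest j v) Bk            ≡⟨ cong (𝟙 once? *_) (count-Bterms p k≤n (t ∷ rest j v)) ⟩
      𝟙 once? * 𝟙 (inB? p n k (t ∷ rest j v))      ≡⟨ 𝟙-× once? (inB? p n k (t ∷ rest j v)) ⟨
      𝟙 (once? ×-dec inB? p n k (t ∷ rest j v))    ≡⟨ 𝟙-cong (Equivalence.to (equiv v)) (Equivalence.from (equiv v))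
                                                        (once? ×-dec inB? p n k (t ∷ rest j v)) (inB? p n k′ v) ⟩
      𝟙 (inB? p n k′ v)                            ≡⟨ count-Bterms p k′≤n v ⟨
      count v (Bterms p n k′)                      ∎
      where
      open ≡-Reasoning
      once? = Countℕ.count j (vals v) ℕ.≟ 1

lemma5 : (p : ℕ) → .{{_ : NonZero p}} → (n k : ℕ) → 1 ≤ k → k < n →
    (B p n k ≈ sumC p n k)
    × ((c : Fin p) (j : ℕ) → 1 ≤ j → j ≤ k → mulQ p (C p n k (c , j)) (B p n 1) ≈ B p n k)
    × (mulQ p (C p n k (c0 p , suc k)) (B p n 1) ≈ B p n (suc k))
lemma5 p n k 1≤k k<n =
  B≈sumC p k<n ,
  (λ c j 1≤j j≤k → C·B₁≈B p k≤n k≤n 1<n c j (tail-avoids-low p j≤k) (InB-rest-low p c 1≤j j≤k)) ,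
  C·B₁≈B p k≤n k<n 1<n (c0 p) (suc k) (tail-avoids-top p k<n) (InB-rest-top p k<n)
  where
  k≤n = ℕ.<⇒≤ k<n
  1<n = ℕ.≤-<-trans 1≤k k<n
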